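{- Let $G=(V,E)$ be a connected graph (loops and multiple edges allowed). If $G$ contains any of the following, then $G$ does not have the strong parity property: (i) a vertex $v$ with $\deg_G(v)=1$; (ii) a path $v_1v_2v_3$ with $\deg_G(v_1)=\deg_G(v_2)=\deg_G(v_3)=2$, and $|V|>3$; (iii) a path $v_1v_2v_3$ and a further vertex $v_4$ such that $\deg_G(v_1)=\deg_G(v_3)=2$, $\deg_G(v_2)=3$, $v_2v_4$ is a cut-edge of $G$, and the component containing $v_2$ in $G-v_4$ has order at least $4$.
   Context: Graphs may have loops and multiple edges; the degree $\deg_G(v)$ counts each loop twice. A factor of $G$ is a spanning subgraph $H$ of $G$ with minimum degree $\delta(H)\ge 1$. For a set $X\subseteq V(G)$ of even cardinality, an $X$-parity-factor of $G$ is a factor $H$ of $G$ such that $\deg_H(v)$ is odd for every $v\in X$ and $\deg_H(v)$ is even for every $v\in V(G)\setminus X$. A graph $G$ has the strong parity property if for every subset $X\subseteq V(G)$ of even cardinality (including $X=\emptyset$), $G$ has an $X$-parity-factor. -}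

module Defs where

open import Data.Nat using (ℕ; _+_; _%_; _≥_; _>_)
open import Data.Fin using (Fin; _≟_)
open import Data.Fin.Subset using (Subset; _∈_; _∉_; ∣_∣)
open import Data.Vec using (tabulate; sum; lookup)
open import Data.Bool using (Bool; true; false; if_then_else_)
open import Data.Product using (Σ; ∃; _×_; _,_; proj₁; proj₂)
open import Data.Sum using (_⊎_)
open import Data.Unit using (⊤)
open import Relation.Nullary using (¬_; does)
open import Relation.Binary.PropositionalEquality using (_≡_; _≢_)

record Graph : Set where
  field
    n    : ℕ
    m    : ℕ
    ends : Fin m → Fin n × Fin n
open Graph public

ind : ∀ {k} → Fin k → Fin k → ℕ
ind a b = if does (a ≟ b) then 1 else 0

-- number of ends of edge e at vertex v (a loop counts twice)
incidence : (G : Graph) → Fin (m G) → Fin (n G) → ℕ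
incidence G e v = ind (proj₁ (ends G e)) v + ind (proj₂ (ends G e)) v

degIn : (G : Graph) → Subset (m G) → Fin (n G) → ℕ
degIn G S v = sum (tabulate (λ e → if lookup S e then incidence G e v else 0))

deg : (G : Graph) → Fin (n G) → ℕ
deg G v = sum (tabulate (λ e → incidence G e v))

IsFactor : (G : Graph) → Subset (m G) → Set
IsFactor G S = ∀ v → degIn G S v ≥ 1

IsParityFactor : (G : Graph) → Subset (n G) → Subset (m G) → Set
IsParityFactor G X S =
  IsFactor G S
  × (∀ v → v ∈ X → degIn G S v % 2 ≡ 1)
  × (∀ v → v ∉ X → degIn G S v % 2 ≡ 0)

StrongParity : Graph → Set
StrongParity G =
  ∀ (X : Subset (n G)) → ∣ X ∣ % 2 ≡ 0 → ∃ λ S → IsParityFactor G X S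

data Reach (G : Graph) (ok : Fin (m G) → Set) (u : Fin (n G)) : Fin (n G) → Set where
  here : Reach G ok u u
  fwd  : ∀ e → ok e → Reach G ok u (proj₁ (ends G e)) → Reach G ok u (proj₂ (ends G e))
  bwd  : ∀ e → ok e → Reach G ok u (proj₂ (ends G e)) → Reach G ok u (proj₁ (ends G e))

Connected : Graph → Set
Connected G = ∀ u v → Reach G (λ _ → ⊤) u v

Joins : (G : Graph) → Fin (m G) → Fin (n G) → Fin (n G) → Set
Joins G e a b = ends G e ≡ (a , b) ⊎ ends G e ≡ (b , a)

Adj : (G : Graph) → Fin (n G) → Fin (n G) → Set
Adj G a b = ∃ λ e → Joins G e a b

Path3 : (G : Graph) → Fin (n G) → Fin (n G) → Fin (n G) → Set
Path3 G a b c = a ≢ b × b ≢ c × a ≢ c × Adj G a b × Adj G b c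

-- e is a cut-edge of the connected graph G: G - e is disconnected
IsCutEdge : (G : Graph) → Fin (m G) → Set
IsCutEdge G e = ¬ (∀ u v → Reach G (λ e' → e' ≢ e) u v)

ReachAvoiding : (G : Graph) → Fin (n G) → Fin (n G) → Fin (n G) → Set
ReachAvoiding G w = Reach G (λ e → proj₁ (ends G e) ≢ w × proj₂ (ends G e) ≢ w)

ComponentOrderAtLeast4 : (G : Graph) → (w u : Fin (n G)) → Set
ComponentOrderAtLeast4 G w u =
  Σ (Fin (n G)) λ a → Σ (Fin (n G)) λ b → Σ (Fin (n G)) λ c → Σ (Fin (n G)) λ d →
    (a ≢ b × a ≢ c × a ≢ d × b ≢ c × b ≢ d × c ≢ d)
    × (a ≢ w × b ≢ w × c ≢ w × d ≢ w)
    × (ReachAvoiding G w u a × ReachAvoiding G w u b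
       × ReachAvoiding G w u c × ReachAvoiding G w u d)

ConfigI : Graph → Set
ConfigI G = ∃ λ v → deg G v ≡ 1

ConfigII : Graph → Set
ConfigII G = n G > 3 × (Σ (Fin (n G)) λ v₁ → Σ (Fin (n G)) λ v₂ → Σ (Fin (n G)) λ v₃ →
  Path3 G v₁ v₂ v₃ × deg G v₁ ≡ 2 × deg G v₂ ≡ 2 × deg G v₃ ≡ 2)

ConfigIII : Graph → Set
ConfigIII G = Σ (Fin (n G)) λ v₁ → Σ (Fin (n G)) λ v₂ → Σ (Fin (n G)) λ v₃ → Σ (Fin (n G)) λ v₄ →
  Path3 G v₁ v₂ v₃
  × (v₄ ≢ v₁ × v₄ ≢ v₂ × v₄ ≢ v₃)
  × deg G v₁ ≡ 2 × deg G v₃ ≡ 2 × deg G v₂ ≡ 3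
  × (∃ λ e → Joins G e v₂ v₄ × IsCutEdge G e)
  × ComponentOrderAtLeast4 G v₄ v₂

module Submission where

-- Let S be an X-parity-factor of G. Two facts about S drive the proof.
--  * Locally: a vertex outside X has positive even S-degree, hence S-degree at least 2;
--    so a degree-2 vertex outside X keeps all its edges in S (`saturated`). If v₁v₂v₃ is
--    a path whose ends have degree 2 and lie outside X, both path edges lie in S, and if
--    moreover v₂ ∈ X then v₂ needs S-degree at least 3 (`path-obstruction`).
--  * Globally: by the handshake lemma taken modulo 2 over a vertex set C, an edge that is
--    the only one leaving C, where C contains the even set X, is not in S (`bridge-avoided`).
-- The theorem follows case by case. (i) For X = ∅ a vertex of degree 1 cannot have
-- S-degree 2. (ii) For X = {v₂, w}, w a fourth vertex, v₂ has degree 2. (iii) For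
-- X = {v₂, w}, w off the path in the component of v₂ in G − v₄, the cut-edge v₂v₄ is not
-- in S, so v₂, of degree 3, has S-degree at most 2.
-- The file develops finite sums over Fin and their parity, degrees relative to an edge set,
-- the parity-factor lemmas, reachability (rerouting around an edge, ¬¬-decidability of a
-- component), the choice of w by pigeonhole, and finally the three cases.

open import Defs
open import Data.Bool using (Bool; true; false; not; if_then_else_)
open import Data.Empty using (⊥; ⊥-elim)
open import Data.Fin using (Fin; zero; suc; _≟_; punchOut)
open import Data.Fin.Properties using (punchIn-punchOut; pigeonhole; any?; ¬∀⟶∃¬; <⇒≢)
open import Data.Fin.Subset using (Subset; _∈_; _∉_; ∣_∣; ⁅_⁆; _∪_) renaming (⊥ to ∅)
open import Data.Fin.Subset.Properties
  using (_∈?_; ∉⊥; ∣⊥∣≡0; x∈⁅x⁆; x∈⁅y⁆⇒x≡y; x∈p∪q⁺; x∈p∪q⁻)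
open import Data.Nat using (ℕ; zero; suc; _+_; _%_; _≤_; _<_; z≤n; s≤s; s≤s⁻¹)
open import Data.Nat.DivMod using (%-distribˡ-+)
open import Data.Nat.Properties
  using (+-0-commutativeMonoid; ≤-refl; ≤-trans; +-mono-≤; m≤m+n; m≤n+m; +-identityʳ;
         ≤-antisym; <⇒≱; m<m+n)
open import Data.Product using (∃; _×_; _,_; proj₁; proj₂)
open import Data.Sum using (_⊎_; inj₁; inj₂)
open import Data.Unit using (⊤; tt)
import Data.Vec as Vec
open import Data.Vec using (Vec; []; _∷_; lookup; allFin)
open import Data.Vec.Functional using (removeAt)
open import Data.Vec.Relation.Unary.All using (All; []; _∷_; universal)
open import Data.Vec.Relation.Unary.All.Properties using (lookup⁺; lookup⁻)
open import Data.Vec.Relation.Unary.AllPairs using ([]; _∷_)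
open import Data.Vec.Relation.Unary.Unique.Propositional using (Unique)
open import Data.Vec.Relation.Unary.Unique.Propositional.Properties
  using (lookup-injective; tabulate⁺)
open import Relation.Binary.Definitions using (DecidableEquality)
open import Relation.Binary.PropositionalEquality
  using (_≡_; _≢_; refl; sym; trans; cong; cong₂; subst; subst₂; module ≡-Reasoning)
open import Relation.Nullary using (¬_; Dec; yes; no; does; ¬¬-excluded-middle)
open import Relation.Nullary.Decidable using (dec-true; dec-false; decidable-stable)
import Data.Bool.Properties as Bool
open import Algebra.Properties.CommutativeMonoid.Sum +-0-commutativeMonoid
  using (sum; sum-syntax; sum-cong-≗; sum-replicate-zero; sum-remove; ∑-distrib-+; ∑-comm)

-- `when b x` is x if b holds and 0 otherwise: Defs counts the degree of v in the
-- subgraph S as the sum over e of `when (lookup S e) (incidence G e v)`.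
when : Bool → ℕ → ℕ
when b x = if b then x else 0

𝟙 : Bool → ℕ
𝟙 b = when b 1

when-0 : ∀ b → when b 0 ≡ 0
when-0 true  = refl
when-0 false = refl

when-+ : ∀ b x y → when b (x + y) ≡ when b x + when b y
when-+ true  x y = refl
when-+ false x y = refl

when-comm : ∀ b c x → when b (when c x) ≡ when c (when b x)
when-comm true  c x = refl
when-comm false c x = sym (when-0 c)

when-split : ∀ b x → when b x + when (not b) x ≡ x
when-split true  x = +-identityʳ x
when-split false x = refl

sum-tabulate : ∀ {k} (f : Fin k → ℕ) → Vec.sum (Vec.tabulate f) ≡ ∑[ i < k ] f i
sum-tabulate {zero}  f = refl
sum-tabulate {suc k} f = cong (f zero +_) (sum-tabulate (λ i → f (suc i)))

∑-when : ∀ {k} b (f : Fin k → ℕ) → when b (∑[ i < k ] f i) ≡ ∑[ i < k ] when b (f i)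
∑-when {k} true  f = refl
∑-when {k} false f = sym (sum-replicate-zero k)

term≤∑ : ∀ {k} (f : Fin k → ℕ) i → f i ≤ ∑[ j < k ] f j
term≤∑ {suc k} f i = subst (f i ≤_) (sym (sum-remove f)) (m≤m+n (f i) _)

terms≤∑ : ∀ {k} (f : Fin k → ℕ) {i j} → i ≢ j → f i + f j ≤ ∑[ l < k ] f l
terms≤∑ {suc k} f {i} {j} i≢j = subst (f i + f j ≤_) (sym (sum-remove f))
  (+-mono-≤ ≤-refl (subst (_≤ sum (removeAt f i)) (cong f (punchIn-punchOut i≢j))
    (term≤∑ (removeAt f i) (punchOut i≢j))))

∑-cong-%2 : ∀ {k} {f g : Fin k → ℕ} → (∀ i → f i % 2 ≡ g i % 2) →
  (∑[ i < k ] f i) % 2 ≡ (∑[ i < k ] g i) % 2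
∑-cong-%2 {zero}  f≡g = refl
∑-cong-%2 {suc k} {f} {g} f≡g = begin
  (f zero + ∑[ i < k ] f (suc i)) % 2
    ≡⟨ %-distribˡ-+ (f zero) _ 2 ⟩
  (f zero % 2 + (∑[ i < k ] f (suc i)) % 2) % 2
    ≡⟨ cong₂ (λ x y → (x + y) % 2) (f≡g zero) (∑-cong-%2 (λ i → f≡g (suc i))) ⟩
  (g zero % 2 + (∑[ i < k ] g (suc i)) % 2) % 2
    ≡⟨ sym (%-distribˡ-+ (g zero) _ 2) ⟩
  (g zero + ∑[ i < k ] g (suc i)) % 2 ∎
  where open ≡-Reasoning

when-cong-%2 : ∀ b {x y} → x % 2 ≡ y % 2 → when b x % 2 ≡ when b y % 2
when-cong-%2 true  x≡y = x≡y
when-cong-%2 false x≡y = refl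

𝟙-different : ∀ {b c} → b ≢ c → 𝟙 b + 𝟙 c ≡ 1
𝟙-different {true}  {true}  b≢c = ⊥-elim (b≢c refl)
𝟙-different {true}  {false} b≢c = refl
𝟙-different {false} {true}  b≢c = refl
𝟙-different {false} {false} b≢c = ⊥-elim (b≢c refl)

𝟙-twice-even : ∀ b → (𝟙 b + 𝟙 b) % 2 ≡ 0
𝟙-twice-even true  = refl
𝟙-twice-even false = refl

𝟙-even⇒false : ∀ b → 𝟙 b % 2 ≡ 0 → b ≡ false
𝟙-even⇒false false _  = refl
𝟙-even⇒false true  ()

even-positive : ∀ x → 1 ≤ x → x % 2 ≡ 0 → 2 ≤ x
even-positive (suc zero)    _ ()
even-positive (suc (suc x)) _ _ = s≤s (s≤s z≤n)

∑-ind : ∀ {k} (c : Fin k → Bool) (a : Fin k) → ∑[ v < k ] when (c v) (ind a v) ≡ 𝟙 (c a)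
∑-ind {suc k} c zero = trans (cong (𝟙 (c zero) +_)
  (trans (sum-cong-≗ (λ v → when-0 (c (suc v)))) (sum-replicate-zero k))) (+-identityʳ _)
∑-ind {suc k} c (suc a) =
  trans (cong (_+ ∑[ v < k ] when (c (suc v)) (ind a v)) (when-0 (c zero)))
        (∑-ind (λ v → c (suc v)) a)

ind-refl : ∀ {k} (a : Fin k) → ind a a ≡ 1
ind-refl a with a ≟ a
... | yes _  = refl
... | no a≢a = ⊥-elim (a≢a refl)

module _ (G : Graph) where

  degOut : Subset (m G) → Fin (n G) → ℕ
  degOut S v = ∑[ e < m G ] when (not (lookup S e)) (incidence G e v)

  degIn-∑ : ∀ S v → degIn G S v ≡ ∑[ e < m G ] when (lookup S e) (incidence G e v)
  degIn-∑ S v = sum-tabulate (λ e → when (lookup S e) (incidence G e v))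

  degIn+degOut : ∀ S v → degIn G S v + degOut S v ≡ deg G v
  degIn+degOut S v = begin
    degIn G S v + degOut S v                 ≡⟨ cong (_+ degOut S v) (degIn-∑ S v) ⟩
    ∑[ e < m G ] inS e + ∑[ e < m G ] outS e  ≡⟨ sym (∑-distrib-+ inS outS) ⟩
    ∑[ e < m G ] (inS e + outS e)            ≡⟨ sum-cong-≗ (λ e → when-split (lookup S e) (incidence G e v)) ⟩
    ∑[ e < m G ] incidence G e v             ≡⟨ sym (sum-tabulate (λ e → incidence G e v)) ⟩
    deg G v                                  ∎
    where
    open ≡-Reasoning
    inS outS : Fin (m G) → ℕ
    inS  e = when (lookup S e) (incidence G e v)
    outS e = when (not (lookup S e)) (incidence G e v)

  degIn≤deg : ∀ S v → degIn G S v ≤ deg G v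
  degIn≤deg S v = subst (degIn G S v ≤_) (degIn+degOut S v) (m≤m+n _ _)

  members≤degIn : ∀ S {e f} v → e ≢ f → lookup S e ≡ true → lookup S f ≡ true →
    incidence G e v + incidence G f v ≤ degIn G S v
  members≤degIn S {e} {f} v e≢f e∈S f∈S =
    subst₂ _≤_ (cong₂ _+_ (contribution e∈S) (contribution f∈S)) (sym (degIn-∑ S v))
      (terms≤∑ (λ g → when (lookup S g) (incidence G g v)) e≢f)
    where
    contribution : ∀ {g} → lookup S g ≡ true → when (lookup S g) (incidence G g v) ≡ incidence G g v
    contribution {g} g∈S = cong (λ b → when b (incidence G g v)) g∈S

  nonmember≤degOut : ∀ S {e} v → lookup S e ≡ false → incidence G e v ≤ degOut S v
  nonmember≤degOut S {e} v e∉S =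
    subst (_≤ degOut S v) (cong (λ b → when (not b) (incidence G e v)) e∉S)
      (term≤∑ (λ f → when (not (lookup S f)) (incidence G f v)) e)

  degIn<deg : ∀ S {e} v → lookup S e ≡ false → 1 ≤ incidence G e v → degIn G S v < deg G v
  degIn<deg S v e∉S incident = subst (degIn G S v <_) (degIn+degOut S v)
    (m<m+n (degIn G S v) (≤-trans incident (nonmember≤degOut S v e∉S)))

  Joins-sym : ∀ {e a b} → Joins G e a b → Joins G e b a
  Joins-sym (inj₁ ends≡ab) = inj₂ ends≡ab
  Joins-sym (inj₂ ends≡ba) = inj₁ ends≡ba

  endpoint-incident : ∀ {e a b} → Joins G e a b → 1 ≤ incidence G e a
  endpoint-incident {e} {a} {b} (inj₁ ends≡ab) rewrite ends≡ab =
    subst (_≤ ind a a + ind b a) (ind-refl a) (m≤m+n _ _)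
  endpoint-incident {e} {a} {b} (inj₂ ends≡ba) rewrite ends≡ba =
    subst (_≤ ind b a + ind a a) (ind-refl a) (m≤n+m _ _)

  Joins-endpoint : ∀ {e a b c d} → Joins G e a b → Joins G e c d → c ≡ a ⊎ c ≡ b
  Joins-endpoint (inj₁ p) (inj₁ q) = inj₁ (cong proj₁ (trans (sym q) p))
  Joins-endpoint (inj₁ p) (inj₂ q) = inj₂ (cong proj₂ (trans (sym q) p))
  Joins-endpoint (inj₂ p) (inj₁ q) = inj₂ (cong proj₁ (trans (sym q) p))
  Joins-endpoint (inj₂ p) (inj₂ q) = inj₁ (cong proj₂ (trans (sym q) p))

  along-Joins : ∀ {ℓ} (R : Fin (n G) → Fin (n G) → Set ℓ) → (∀ {x y} → R x y → R y x) →
    ∀ {e a b} → Joins G e a b → R a b → R (proj₁ (ends G e)) (proj₂ (ends G e))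
  along-Joins R R-sym (inj₁ ends≡ab) r rewrite ends≡ab = r
  along-Joins R R-sym (inj₂ ends≡ba) r rewrite ends≡ba = R-sym r

  endsIn : (Fin (n G) → Bool) → Fin (m G) → ℕ
  endsIn c e = 𝟙 (c (proj₁ (ends G e))) + 𝟙 (c (proj₂ (ends G e)))

  endsIn-∑ : ∀ c e → ∑[ v < n G ] when (c v) (incidence G e v) ≡ endsIn c e
  endsIn-∑ c e = trans (sum-cong-≗ (λ v → when-+ (c v) _ _))
    (trans (∑-distrib-+ (sift (proj₁ (ends G e))) (sift (proj₂ (ends G e))))
      (cong₂ _+_ (∑-ind c _) (∑-ind c _)))
    where
    sift : Fin (n G) → Fin (n G) → ℕ
    sift a v = when (c v) (ind a v)

  handshake : ∀ S (c : Fin (n G) → Bool) →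
    ∑[ v < n G ] when (c v) (degIn G S v) ≡ ∑[ e < m G ] when (lookup S e) (endsIn c e)
  handshake S c = begin
    ∑[ v < n G ] when (c v) (degIn G S v)
      ≡⟨ sum-cong-≗ (λ v → trans (cong (when (c v)) (degIn-∑ S v))
                                       (∑-when (c v) (λ e → when (lookup S e) (incidence G e v)))) ⟩
    ∑[ v < n G ] ∑[ e < m G ] when (c v) (when (lookup S e) (incidence G e v))
      ≡⟨ ∑-comm (λ v e → when (c v) (when (lookup S e) (incidence G e v))) ⟩
    ∑[ e < m G ] ∑[ v < n G ] when (c v) (when (lookup S e) (incidence G e v))
      ≡⟨ sum-cong-≗ (λ e → trans (sum-cong-≗ (λ v → when-comm (c v) (lookup S e) _))
                                 (sym (∑-when (lookup S e) (λ v → when (c v) (incidence G e v))))) ⟩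
    ∑[ e < m G ] when (lookup S e) (∑[ v < n G ] when (c v) (incidence G e v))
      ≡⟨ sum-cong-≗ (λ e → cong (when (lookup S e)) (endsIn-∑ c e)) ⟩
    ∑[ e < m G ] when (lookup S e) (endsIn c e) ∎
    where open ≡-Reasoning

∣∣-∑ : ∀ {k} (p : Subset k) → ∣ p ∣ ≡ ∑[ v < k ] 𝟙 (does (v ∈? p))
∣∣-∑ []          = refl
∣∣-∑ (true  ∷ p) = cong suc (∣∣-∑ p)
∣∣-∑ (false ∷ p) = ∣∣-∑ p

module ParityFactor (G : Graph) (X : Subset (n G)) (S : Subset (m G))
                    (pf : IsParityFactor G X S) where

  private
    odd-in-X : ∀ {v} → v ∈ X → degIn G S v % 2 ≡ 1
    odd-in-X = proj₁ (proj₂ pf) _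
    even-outside-X : ∀ {v} → v ∉ X → degIn G S v % 2 ≡ 0
    even-outside-X = proj₂ (proj₂ pf) _

  -- A vertex outside X has positive even S-degree, hence meets at least two edge-ends of S.
  outside≥2 : ∀ {v} → v ∉ X → 2 ≤ degIn G S v
  outside≥2 {v} v∉X = even-positive _ (proj₁ pf v) (even-outside-X v∉X)

  saturated : ∀ {v e} → v ∉ X → deg G v ≡ 2 → 1 ≤ incidence G e v → lookup S e ≡ true
  saturated {v} {e} v∉X deg≡2 incident with lookup S e in e∈?S
  ... | true  = refl
  ... | false = ⊥-elim (<⇒≱ (subst (degIn G S v <_) deg≡2 (degIn<deg G S v e∈?S incident))
                          (outside≥2 v∉X))

  -- The middle vertex of a path v₁v₂v₃ whose ends have degree 2 and lie outside X keeps
  -- both path edges; lying in X, it needs a third edge-end of S.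
  path-obstruction : ∀ {v₁ v₂ v₃} → Path3 G v₁ v₂ v₃ → deg G v₁ ≡ 2 → deg G v₃ ≡ 2 →
    v₁ ∉ X → v₂ ∈ X → v₃ ∉ X → degIn G S v₂ ≤ 2 → ⊥
  path-obstruction {v₁} {v₂} {v₃} (v₁≢v₂ , v₂≢v₃ , v₁≢v₃ , (e₁₂ , J₁₂) , (e₂₃ , J₂₃))
                   deg₁ deg₃ v₁∉X v₂∈X v₃∉X ≤2 =
    two-is-even (subst (λ d → d % 2 ≡ 1) (≤-antisym ≤2 ≥2) (odd-in-X v₂∈X))
    where
    two-is-even : 2 % 2 ≢ 1
    two-is-even ()
    e₁₂≢e₂₃ : e₁₂ ≢ e₂₃
    e₁₂≢e₂₃ refl with Joins-endpoint G J₁₂ (Joins-sym G J₂₃)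
    ... | inj₁ v₃≡v₁ = v₁≢v₃ (sym v₃≡v₁)
    ... | inj₂ v₃≡v₂ = v₂≢v₃ (sym v₃≡v₂)
    ≥2 : 2 ≤ degIn G S v₂
    ≥2 = ≤-trans (+-mono-≤ (endpoint-incident G (Joins-sym G J₁₂)) (endpoint-incident G J₂₃))
           (members≤degIn G S v₂ e₁₂≢e₂₃
             (saturated v₁∉X deg₁ (endpoint-incident G J₁₂))
             (saturated v₃∉X deg₃ (endpoint-incident G (Joins-sym G J₂₃))))

  -- Both sides of the handshake lemma are
  -- computed modulo 2.
  bridge-avoided : (c : Fin (n G) → Bool) (e₀ : Fin (m G)) → ∣ X ∣ % 2 ≡ 0 →
    (∀ v → v ∈ X → c v ≡ true) →
    (∀ e → e ≢ e₀ → c (proj₁ (ends G e)) ≡ c (proj₂ (ends G e))) →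
    c (proj₁ (ends G e₀)) ≢ c (proj₂ (ends G e₀)) → lookup S e₀ ≡ false
  bridge-avoided c e₀ ∣X∣-even X⊆c closed leaves = 𝟙-even⇒false (lookup S e₀) parity
    where
    vertex-parity : ∀ v → when (c v) (degIn G S v) % 2 ≡ 𝟙 (does (v ∈? X)) % 2
    vertex-parity v with v ∈? X
    ... | yes v∈X rewrite X⊆c v v∈X = odd-in-X v∈X
    ... | no v∉X with c v
    ...   | true  = even-outside-X v∉X
    ...   | false = refl
    edge-parity : ∀ e → when (lookup S e) (endsIn G c e) % 2 ≡ when (lookup S e) (ind e₀ e) % 2
    edge-parity e with e₀ ≟ e
    ... | yes refl = cong (λ x → when (lookup S e₀) x % 2) (𝟙-different leaves)
    ... | no e₀≢e = when-cong-%2 (lookup S e) (begin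
      endsIn G c e % 2                   ≡⟨ cong (λ b → (𝟙 b + 𝟙 (c (proj₂ (ends G e)))) % 2)
                                               (closed e (λ e≡e₀ → e₀≢e (sym e≡e₀))) ⟩
      (𝟙 (c (proj₂ (ends G e))) + 𝟙 (c (proj₂ (ends G e)))) % 2
                                         ≡⟨ 𝟙-twice-even (c (proj₂ (ends G e))) ⟩
      0 ∎)
      where open ≡-Reasoning
    parity : 𝟙 (lookup S e₀) % 2 ≡ 0
    parity = begin
      𝟙 (lookup S e₀) % 2                                    ≡⟨ cong (_% 2) (sym (∑-ind (lookup S) e₀)) ⟩
      (∑[ e < m G ] when (lookup S e) (ind e₀ e)) % 2        ≡⟨ sym (∑-cong-%2 edge-parity) ⟩
      (∑[ e < m G ] when (lookup S e) (endsIn G c e)) % 2    ≡⟨ cong (_% 2) (sym (handshake G S c)) ⟩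
      (∑[ v < n G ] when (c v) (degIn G S v)) % 2            ≡⟨ ∑-cong-%2 vertex-parity ⟩
      (∑[ v < n G ] 𝟙 (does (v ∈? X))) % 2                   ≡⟨ cong (_% 2) (sym (∣∣-∑ X)) ⟩
      ∣ X ∣ % 2                                              ≡⟨ ∣X∣-even ⟩
      0 ∎
      where open ≡-Reasoning

module _ {G : Graph} {ok : Fin (m G) → Set} where

  Reach-trans : ∀ {u v w} → Reach G ok u v → Reach G ok v w → Reach G ok u w
  Reach-trans p here        = p
  Reach-trans p (fwd e o q) = fwd e o (Reach-trans p q)
  Reach-trans p (bwd e o q) = bwd e o (Reach-trans p q)

  Reach-sym : ∀ {u v} → Reach G ok u v → Reach G ok v u
  Reach-sym here        = here
  Reach-sym (fwd e o q) = Reach-trans (bwd e o here) (Reach-sym q)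
  Reach-sym (bwd e o q) = Reach-trans (fwd e o here) (Reach-sym q)

Reach-mono : ∀ {G : Graph} {ok ok′ : Fin (m G) → Set} → (∀ e → ok e → ok′ e) →
  ∀ {u v} → Reach G ok u v → Reach G ok′ u v
Reach-mono ok⇒ok′ here        = here
Reach-mono ok⇒ok′ (fwd e o q) = fwd e (ok⇒ok′ e o) (Reach-mono ok⇒ok′ q)
Reach-mono ok⇒ok′ (bwd e o q) = bwd e (ok⇒ok′ e o) (Reach-mono ok⇒ok′ q)

Avoiding : (G : Graph) → Fin (m G) → Fin (m G) → Set
Avoiding G e₀ e = e ≢ e₀

reroute : (G : Graph) (e₀ : Fin (m G)) →
  Reach G (Avoiding G e₀) (proj₁ (ends G e₀)) (proj₂ (ends G e₀)) →
  ∀ {u v} → Reach G (λ _ → ⊤) u v → Reach G (Avoiding G e₀) u v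
reroute G e₀ detour here = here
reroute G e₀ detour (fwd e _ q) with e ≟ e₀
... | yes refl = Reach-trans (reroute G e₀ detour q) detour
... | no e≢e₀  = fwd e e≢e₀ (reroute G e₀ detour q)
reroute G e₀ detour (bwd e _ q) with e ≟ e₀
... | yes refl = Reach-trans (reroute G e₀ detour q) (Reach-sym detour)
... | no e≢e₀  = bwd e e≢e₀ (reroute G e₀ detour q)

cut-edge-separates : (G : Graph) → Connected G → ∀ {e₀} → IsCutEdge G e₀ →
  ¬ Reach G (Avoiding G e₀) (proj₁ (ends G e₀)) (proj₂ (ends G e₀))
cut-edge-separates G conn {e₀} cut detour = cut (λ u v → reroute G e₀ detour (conn u v))

-- Constructively, a finite family of propositions is not not decidable; this lets us
-- use the vertex set of a component while proving a negation.
¬¬-decidable : ∀ k (P : Fin k → Set) → ¬ ¬ (∀ i → Dec (P i))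
¬¬-decidable zero    P no-dec = no-dec (λ ())
¬¬-decidable (suc k) P no-dec = ¬¬-excluded-middle λ P₀? →
  ¬¬-decidable k (λ i → P (suc i)) λ P? → no-dec λ { zero → P₀? ; (suc i) → P? i }

avoid-vertex⇒avoid-edge : (G : Graph) → ∀ {e₀ u v x y} → Joins G e₀ u v →
  ReachAvoiding G v x y → Reach G (Avoiding G e₀) x y
avoid-vertex⇒avoid-edge G {e₀} {u} {v} J₀ = Reach-mono avoids-e₀
  where
  avoids-e₀ : ∀ e → (proj₁ (ends G e) ≢ v × proj₂ (ends G e) ≢ v) → e ≢ e₀
  avoids-e₀ e avoids refl =
    along-Joins G (λ x y → ¬ (x ≢ v × y ≢ v)) (λ { ¬avoid (y≢v , x≢v) → ¬avoid (x≢v , y≢v) })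
      J₀ (λ { (_ , v≢v) → v≢v refl }) avoids

-- The side of u is the
-- vertex set of its component in G − e₀, which may be assumed decidable since the
-- conclusion is a decidable statement.
cut-edge-avoided : (G : Graph) → Connected G → ∀ X S → IsParityFactor G X S →
  ∣ X ∣ % 2 ≡ 0 → ∀ {e₀ u v} → Joins G e₀ u v → IsCutEdge G e₀ →
  (∀ x → x ∈ X → Reach G (Avoiding G e₀) u x) → lookup S e₀ ≡ false
cut-edge-avoided G conn X S pf ∣X∣-even {e₀} {u} {v} J₀ cut X-near =
  decidable-stable (lookup S e₀ Bool.≟ false) λ e₀∈S →
    ¬¬-decidable (n G) (Reach G (Avoiding G e₀) u) λ near? → e₀∈S (avoided near?)
  where
  v-far : ¬ Reach G (Avoiding G e₀) u v
  v-far r = cut-edge-separates G conn cut (along-Joins G (Reach G (Avoiding G e₀)) Reach-sym J₀ r)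
  module _ (near? : ∀ x → Dec (Reach G (Avoiding G e₀) u x)) where
    side : Fin (n G) → Bool
    side x = does (near? x)
    closed : ∀ e → e ≢ e₀ → side (proj₁ (ends G e)) ≡ side (proj₂ (ends G e))
    closed e e≢e₀ with near? (proj₁ (ends G e)) | near? (proj₂ (ends G e))
    ... | yes _ | yes _ = refl
    ... | no _  | no _  = refl
    ... | yes r | no ¬r = ⊥-elim (¬r (fwd e e≢e₀ r))
    ... | no ¬r | yes r = ⊥-elim (¬r (bwd e e≢e₀ r))
    leaves : side (proj₁ (ends G e₀)) ≢ side (proj₂ (ends G e₀))
    leaves = along-Joins G (λ x y → side x ≢ side y) (λ x≢y y≡x → x≢y (sym y≡x)) J₀
      (subst₂ _≢_ (sym (dec-true (near? u) here)) (sym (dec-false (near? v) v-far)) λ ())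
    avoided : lookup S e₀ ≡ false
    avoided = bridge-avoided side e₀ ∣X∣-even (λ x x∈X → dec-true (near? x) (X-near x x∈X))
                closed leaves
      where open ParityFactor G X S pf

escape : ∀ {a p} {A : Set a} {P : A → Set p} → DecidableEquality A → ∀ {k l} → k < l →
  (xs : Vec A l) → Unique xs → All P xs → (ys : Vec A k) → ∃ λ x → P x × All (x ≢_) ys
escape {A = A} _≟ᴬ_ {k} {l} k<l xs xs-unique P-xs ys with ¬∀⟶∃¬ l hit hit? all-hit
  where
  hit : Fin l → Set _
  hit i = ∃ λ j → lookup xs i ≡ lookup ys j
  hit? : ∀ i → Dec (hit i)
  hit? i = any? (λ j → lookup xs i ≟ᴬ lookup ys j)
  all-hit : ¬ (∀ i → hit i)
  all-hit hits with pigeonhole k<l (λ i → proj₁ (hits i))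
  ... | i , i′ , i<i′ , same = <⇒≢ i<i′ (lookup-injective xs-unique i i′
          (trans (proj₂ (hits i)) (trans (cong (lookup ys) same) (sym (proj₂ (hits i′))))))
... | i , miss = lookup xs i , lookup⁺ P-xs i , lookup⁻ (λ j same → miss (j , same))

pair : ∀ {k} → Fin k → Fin k → Subset k
pair a b = ⁅ a ⁆ ∪ ⁅ b ⁆

∈pairˡ : ∀ {k} (a b : Fin k) → a ∈ pair a b
∈pairˡ a b = x∈p∪q⁺ (inj₁ (x∈⁅x⁆ a))

∈pairʳ : ∀ {k} (a b : Fin k) → b ∈ pair a b
∈pairʳ a b = x∈p∪q⁺ (inj₂ (x∈⁅x⁆ b))

∉pair : ∀ {k} {a b v : Fin k} → v ≢ a → v ≢ b → v ∉ pair a b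
∉pair {a = a} {b} v≢a v≢b v∈ with x∈p∪q⁻ ⁅ a ⁆ ⁅ b ⁆ v∈
... | inj₁ v∈⁅a⁆ = v≢a (x∈⁅y⁆⇒x≡y a v∈⁅a⁆)
... | inj₂ v∈⁅b⁆ = v≢b (x∈⁅y⁆⇒x≡y b v∈⁅b⁆)

∣pair∣ : ∀ {k} {a b : Fin k} → a ≢ b → ∣ pair a b ∣ ≡ 2
∣pair∣ {k} {a} {b} a≢b = begin
  ∣ pair a b ∣                              ≡⟨ ∣∣-∑ (pair a b) ⟩
  ∑[ v < k ] 𝟙 (does (v ∈? pair a b))      ≡⟨ sum-cong-≗ indicator ⟩
  ∑[ v < k ] (ind a v + ind b v)           ≡⟨ ∑-distrib-+ (ind a) (ind b) ⟩
  ∑[ v < k ] ind a v + ∑[ v < k ] ind b v  ≡⟨ cong₂ _+_ (∑-ind (λ _ → true) a) (∑-ind (λ _ → true) b) ⟩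
  2 ∎
  where
  open ≡-Reasoning
  indicator : ∀ v → 𝟙 (does (v ∈? pair a b)) ≡ ind a v + ind b v
  indicator v with a ≟ v | b ≟ v | v ∈? pair a b
  ... | yes refl | yes refl | _       = ⊥-elim (a≢b refl)
  ... | yes refl | no _     | yes _   = refl
  ... | yes refl | no _     | no v∉   = ⊥-elim (v∉ (∈pairˡ a b))
  ... | no _     | yes refl | yes _   = refl
  ... | no _     | yes refl | no v∉   = ⊥-elim (v∉ (∈pairʳ a b))
  ... | no a≢v   | no b≢v   | yes v∈  = ⊥-elim (∉pair (λ v≡a → a≢v (sym v≡a)) (λ v≡b → b≢v (sym v≡b)) v∈)
  ... | no _     | no _     | no _    = refl

module _ (G : Graph) {v₁ v₂ v₃ w : Fin (n G)} where

  pair-obstruction : (S : Subset (m G)) → Path3 G v₁ v₂ v₃ → All (w ≢_) (v₁ ∷ v₂ ∷ v₃ ∷ []) →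
    deg G v₁ ≡ 2 → deg G v₃ ≡ 2 → IsParityFactor G (pair v₂ w) S → degIn G S v₂ ≤ 2 → ⊥
  pair-obstruction S path@(v₁≢v₂ , v₂≢v₃ , _) (w≢v₁ ∷ _ ∷ w≢v₃ ∷ []) deg₁ deg₃ pf =
    path-obstruction path deg₁ deg₃
      (∉pair v₁≢v₂ (λ v₁≡w → w≢v₁ (sym v₁≡w))) (∈pairˡ v₂ w)
      (∉pair (λ v₃≡v₂ → v₂≢v₃ (sym v₃≡v₂)) (λ v₃≡w → w≢v₃ (sym v₃≡w)))
    where open ParityFactor G (pair v₂ w) S pf

  pair-even : All (w ≢_) (v₁ ∷ v₂ ∷ v₃ ∷ []) → ∣ pair v₂ w ∣ % 2 ≡ 0
  pair-even (_ ∷ w≢v₂ ∷ _) = cong (_% 2) (∣pair∣ (λ v₂≡w → w≢v₂ (sym v₂≡w)))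

-- (i) A vertex of degree 1 would need S-degree ≥ 2 in an ∅-parity-factor.
no-leaf : (G : Graph) → ConfigI G → ¬ StrongParity G
no-leaf G (v , deg≡1) strong with strong ∅ (cong (_% 2) (∣⊥∣≡0 (n G)))
... | S , pf = <⇒≱ (s≤s (subst (degIn G S v ≤_) deg≡1 (degIn≤deg G S v))) (outside≥2 ∉⊥)
  where open ParityFactor G ∅ S pf

-- (ii) Take X = {v₂, w} for any fourth vertex w; v₂ has degree 2.
no-degree-two-path : (G : Graph) → ConfigII G → ¬ StrongParity G
no-degree-two-path G (n>3 , v₁ , v₂ , v₃ , path , deg₁ , deg₂ , deg₃) strong
  with escape _≟_ n>3 (allFin (n G)) (tabulate⁺ (λ same → same))
         (universal {P = λ _ → ⊤} (λ _ → tt) _) (v₁ ∷ v₂ ∷ v₃ ∷ [])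
... | w , _ , fresh with strong (pair v₂ w) (pair-even G fresh)
... | S , pf = pair-obstruction G S path fresh deg₁ deg₃ pf
  (subst (degIn G S v₂ ≤_) deg₂ (degIn≤deg G S v₂))

-- (iii) Take X = {v₂, w} for a vertex w off the path in the component of v₂ in G − v₄.
-- The cut-edge v₂v₄ is then not in S, so v₂, of degree 3, has S-degree at most 2.
no-pendant-claw : (G : Graph) → Connected G → ConfigIII G → ¬ StrongParity G
no-pendant-claw G conn
  (v₁ , v₂ , v₃ , v₄ , path , _ , deg₁ , deg₃ , deg₂ , (e₀ , J₀ , cut) ,
   (a , b , c , d , (a≢b , a≢c , a≢d , b≢c , b≢d , c≢d) , _ , (ra , rb , rc , rd)))
  strong
  with escape _≟_ (s≤s (s≤s (s≤s (s≤s z≤n)))) (a ∷ b ∷ c ∷ d ∷ [])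
         ((a≢b ∷ a≢c ∷ a≢d ∷ []) ∷ (b≢c ∷ b≢d ∷ []) ∷ (c≢d ∷ []) ∷ [] ∷ [])
         (ra ∷ rb ∷ rc ∷ rd ∷ []) (v₁ ∷ v₂ ∷ v₃ ∷ [])
... | w , w-near , fresh with strong (pair v₂ w) (pair-even G fresh)
... | S , pf = pair-obstruction G S path fresh deg₁ deg₃ pf
  (s≤s⁻¹ (subst (degIn G S v₂ <_) deg₂ (degIn<deg G S v₂ e₀∉S (endpoint-incident G J₀))))
  where
  X-near : ∀ x → x ∈ pair v₂ w → Reach G (Avoiding G e₀) v₂ x
  X-near x x∈X with x∈p∪q⁻ ⁅ v₂ ⁆ ⁅ w ⁆ x∈X
  ... | inj₁ x∈⁅v₂⁆ rewrite x∈⁅y⁆⇒x≡y v₂ x∈⁅v₂⁆ = here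
  ... | inj₂ x∈⁅w⁆  rewrite x∈⁅y⁆⇒x≡y w x∈⁅w⁆   = avoid-vertex⇒avoid-edge G J₀ w-near
  e₀∉S : lookup S e₀ ≡ false
  e₀∉S = cut-edge-avoided G conn (pair v₂ w) S pf (pair-even G fresh) J₀ cut X-near

mainTheorem1 : (G : Graph) → Connected G →
    (ConfigI G ⊎ ConfigII G ⊎ ConfigIII G) → ¬ StrongParity G
mainTheorem1 G conn (inj₁ leaf)        = no-leaf G leaf
mainTheorem1 G conn (inj₂ (inj₁ path)) = no-degree-two-path G path
mainTheorem1 G conn (inj₂ (inj₂ claw)) = no-pendant-claw G conn claw
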